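{- Let $\mathcal{A}=\{a,b\}$ be a set with $a\ne b$. The paperfolding word on $\mathcal{A}$ satisfies property $\spadesuit$ with constant $c=13$.
   Context: The paperfolding sequence on $\{a,b\}$ is $(a_n)_{n\ge1}$ defined by writing $n=2^km$ with $m$ odd and setting $a_n=a$ if $m\equiv1\pmod 4$ and $a_n=b$ otherwise; the paperfolding word is $a_1a_2a_3\cdots$. For a finite word $\omega$, $|\omega|$ is its length. An infinite word $\omega$ has property $\spadesuit$ with constant $c\ge0$ if $\omega$ is not ultimately periodic and there exist sequences $(U_n),(V_n),(W_n)$ of finite words such that for every $n\ge1$ the word $W_nU_nV_nU_n$ is a prefix of $\omega$, $\max(|V_n|/|U_n|,|W_n|/|U_n|)\le c$ for every $n\ge1$, and $(|U_n|)_n$ is unbounded. -}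

module Defs where

open import Data.Nat using (ℕ; zero; suc; _+_; _*_; _≤_; _<_; _%_; _/_; _≡ᵇ_)
open import Data.Bool using (Bool; true; false; if_then_else_)
open import Data.List using (List; []; _∷_; length; _++_)
open import Data.Product using (Σ; _×_; _,_; ∃)
open import Data.Unit using (⊤)
open import Relation.Binary.PropositionalEquality using (_≡_)
open import Relation.Nullary using (¬_)

InfWord : Set → Set
InfWord A = ℕ → A

-- Odd part of n (n = 2^k * m with m odd), computed with fuel; fuel n suffices for n ≥ 1.
oddPartFuel : ℕ → ℕ → ℕ
oddPartFuel zero    n = n
oddPartFuel (suc f) zero = zero
oddPartFuel (suc f) (suc n) =
  if (suc n % 2) ≡ᵇ 0 then oddPartFuel f (suc n / 2) else suc n

oddPart : ℕ → ℕ
oddPart n = oddPartFuel n n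

-- The paperfolding word on {a,b}: position i (0-based) carries a_{i+1}, where
-- a_n = a if the odd part m of n satisfies m ≡ 1 (mod 4), and b otherwise.
paperfolding : {A : Set} → A → A → InfWord A
paperfolding a b i = if (oddPart (suc i) % 4) ≡ᵇ 1 then a else b

IsPrefix : {A : Set} → List A → InfWord A → Set
IsPrefix []       ω = ⊤
IsPrefix (x ∷ xs) ω = (x ≡ ω 0) × IsPrefix xs (λ i → ω (suc i))

UltimatelyPeriodic : {A : Set} → InfWord A → Set
UltimatelyPeriodic ω =
  Σ ℕ λ p → Σ ℕ λ N → (1 ≤ p) × ((n : ℕ) → N ≤ n → ω (n + p) ≡ ω n)

-- Property ♠ with constant c (a natural number here; the ratio bounds
-- |V|/|U| ≤ c, |W|/|U| ≤ c are written multiplicatively with |U| > 0).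
Spade : {A : Set} → ℕ → InfWord A → Set
Spade {A} c ω =
  ¬ UltimatelyPeriodic ω ×
  Σ (ℕ → List A) λ U → Σ (ℕ → List A) λ V → Σ (ℕ → List A) λ W →
    ((n : ℕ) → IsPrefix (W n ++ U n ++ V n ++ U n) ω) ×
    ((n : ℕ) → 0 < length (U n)) ×
    ((n : ℕ) → length (V n) ≤ c * length (U n)) ×
    ((n : ℕ) → length (W n) ≤ c * length (U n)) ×
    ((B : ℕ) → Σ ℕ λ n → B < length (U n))

{-# OPTIONS --safe #-}
module Submission where

-- With positions counted from 0, the paperfolding word w satisfies w (2i+1) = w i,
-- w (4k) = a and w (4k+2) = b. These three rules show that shifting by 2^(n+2) fixes
-- the first 2^n letters, so w begins with U V U where |U| = 2^n and |V| = 3 · 2^n.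
-- An odd period p is impossible because 4k + 2p ≡ 2 (mod 4), and an even period 2q
-- yields the period q through w (2i+1) = w i, so by descent w has no period at all.

open import Defs
open import Relation.Binary.PropositionalEquality
  using (_≡_; _≢_; refl; sym; trans; cong; subst; module ≡-Reasoning)
open import Data.Nat using (ℕ; zero; suc; _+_; _*_; _^_; _≤_; _<_; _%_; _/_; _≡ᵇ_; z≤n; s≤s)
open import Data.Nat.Properties
open import Data.Nat.DivMod using (m*n%n≡0; m*n/n≡m; m/n<m; [m+kn]%n≡m%n)
open import Data.Nat.Induction using (<-wellFounded)
open import Data.Nat.Tactic.RingSolver using (solve-∀)
open import Data.Bool using (true; false; if_then_else_)
open import Data.List using (List; []; _++_; applyUpTo; length)
open import Data.List.Properties using (length-applyUpTo)
open import Data.Product using (Σ; _,_)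
open import Data.Unit using (tt)
open import Function using (_∘_)
open import Induction.WellFounded using (Acc; acc)
open import Relation.Nullary using (¬_)

open ≡-Reasoning

data ParityView : ℕ → Set where
  even : ∀ j → ParityView (j * 2)
  odd  : ∀ j → ParityView (1 + j * 2)

parityView : ∀ n → ParityView n
parityView zero = even 0
parityView (suc zero) = odd 0
parityView (suc (suc n)) with parityView n
... | even j = even (suc j)
... | odd j = odd (suc j)

n<2^n : ∀ n → n < 2 ^ n
n<2^n zero = s≤s z≤n
n<2^n (suc n) =
  +-mono-≤ (m^n>0 2 n) (≤-trans (n<2^n n) (≤-reflexive (sym (+-identityʳ (2 ^ n)))))

oddPartFuel-zero : ∀ f → oddPartFuel f 0 ≡ 0
oddPartFuel-zero zero = refl
oddPartFuel-zero (suc f) = refl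

oddPartFuel-irrelevant : ∀ f g n → n ≤ f → n ≤ g → oddPartFuel f n ≡ oddPartFuel g n
oddPartFuel-irrelevant f g zero _ _ = trans (oddPartFuel-zero f) (sym (oddPartFuel-zero g))
oddPartFuel-irrelevant (suc f) (suc g) (suc n) (s≤s n≤f) (s≤s n≤g) with suc n % 2 ≡ᵇ 0
... | true = oddPartFuel-irrelevant f g (suc n / 2) (half≤ n≤f) (half≤ n≤g)
  where
  half≤ : ∀ {h} → n ≤ h → suc n / 2 ≤ h
  half≤ n≤h = ≤-trans (≤-pred (m/n<m (suc n) 2 (s≤s (s≤s z≤n)))) n≤h
... | false = refl

oddPartFuel-odd : ∀ f n → suc n % 2 ≡ 1 → oddPartFuel (suc f) (suc n) ≡ suc n
oddPartFuel-odd f n 1+n-odd rewrite 1+n-odd = refl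

oddPartFuel-double : ∀ f n → oddPartFuel (suc f) (n * 2) ≡ oddPartFuel f n
oddPartFuel-double f zero = sym (oddPartFuel-zero f)
oddPartFuel-double f n@(suc _) rewrite m*n%n≡0 n 2 ⦃ _ ⦄ | m*n/n≡m n 2 ⦃ _ ⦄ = refl

oddPart-double : ∀ n → oddPart (n * 2) ≡ oddPart n
oddPart-double zero = refl
oddPart-double (suc n) =
  trans (oddPartFuel-double (suc (n * 2)) (suc n))
        (oddPartFuel-irrelevant _ _ (suc n) (s≤s (m≤m*n n 2)) ≤-refl)

[r+4k]%4≡r%4 : ∀ r k → (r + k * 2 * 2) % 4 ≡ r % 4
[r+4k]%4≡r%4 r k = trans (cong (λ m → (r + m) % 4) (*-assoc k 2 2)) ([m+kn]%n≡m%n r k 4)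

PeriodicFrom : {A : Set} → ℕ → ℕ → InfWord A → Set
PeriodicFrom N p ω = ∀ n → N ≤ n → ω (n + p) ≡ ω n

module _ {A : Set} where

  applyUpTo-++-IsPrefix : ∀ (ω : InfWord A) L {ys} →
    IsPrefix ys (λ i → ω (L + i)) → IsPrefix (applyUpTo ω L ++ ys) ω
  applyUpTo-++-IsPrefix ω zero ys≺ = ys≺
  applyUpTo-++-IsPrefix ω (suc L) ys≺ = refl , applyUpTo-++-IsPrefix (ω ∘ suc) L ys≺

  applyUpTo-IsPrefix : ∀ (ω ω′ : InfWord A) L →
    (∀ i → i < L → ω i ≡ ω′ i) → IsPrefix (applyUpTo ω L) ω′
  applyUpTo-IsPrefix ω ω′ zero agree = tt
  applyUpTo-IsPrefix ω ω′ (suc L) agree =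
    agree 0 (s≤s z≤n) ,
    applyUpTo-IsPrefix (ω ∘ suc) (ω′ ∘ suc) L (λ i → agree (suc i) ∘ s≤s)

  UVU-IsPrefix : ∀ (ω : InfWord A) L M → (∀ i → i < L → ω (L + M + i) ≡ ω i) →
    IsPrefix (applyUpTo ω L ++ applyUpTo (λ i → ω (L + i)) M ++ applyUpTo ω L) ω
  UVU-IsPrefix ω L M returns = applyUpTo-++-IsPrefix ω L (applyUpTo-++-IsPrefix (λ i → ω (L + i)) M
    (applyUpTo-IsPrefix ω _ L returns′))
    where
    returns′ : ∀ i → i < L → ω i ≡ ω (L + (M + i))
    returns′ i i<L = sym (trans (cong ω (sym (+-assoc L M i))) (returns i i<L))

module Paperfolding {A : Set} (a b : A) where

  w : InfWord A
  w = paperfolding a b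

  -- w n ≡ letterOf (oddPart (suc n)) holds definitionally.
  letterOf : ℕ → A
  letterOf m = if m % 4 ≡ᵇ 1 then a else b

  letterOf-mod4 : ∀ r k → letterOf (r + k * 2 * 2) ≡ letterOf r
  letterOf-mod4 r k = cong (λ m → if m ≡ᵇ 1 then a else b) ([r+4k]%4≡r%4 r k)

  w-odd-position : ∀ n → suc n % 2 ≡ 1 → w n ≡ letterOf (suc n)
  w-odd-position n 1+n-odd = cong letterOf (oddPartFuel-odd n n 1+n-odd)

  w[4k]≡a : ∀ k → w (k * 2 * 2) ≡ a
  w[4k]≡a k = trans (w-odd-position (k * 2 * 2) ([m+kn]%n≡m%n 1 (k * 2) 2)) (letterOf-mod4 1 k)

  w[4k+2]≡b : ∀ k → w ((1 + k * 2) * 2) ≡ b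
  w[4k+2]≡b k =
    trans (w-odd-position ((1 + k * 2) * 2) ([m+kn]%n≡m%n 1 (1 + k * 2) 2)) (letterOf-mod4 3 k)

  w[2i+1]≡w[i] : ∀ i → w (1 + i * 2) ≡ w i
  w[2i+1]≡w[i] i = cong letterOf (oddPart-double (suc i))

  w[4m+2j]≡w[2j] : ∀ m j → w (m * 4 + j * 2) ≡ w (j * 2)
  w[4m+2j]≡w[2j] m j with parityView j
  ... | even k = begin
    w (m * 4 + k * 2 * 2)   ≡⟨ cong w (index m k) ⟩
    w ((m + k) * 2 * 2)     ≡⟨ w[4k]≡a (m + k) ⟩
    a                       ≡⟨ w[4k]≡a k ⟨
    w (k * 2 * 2)           ∎
    where
    index : ∀ m k → m * 4 + k * 2 * 2 ≡ (m + k) * 2 * 2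
    index = solve-∀
  ... | odd k = begin
    w (m * 4 + (1 + k * 2) * 2)   ≡⟨ cong w (index m k) ⟩
    w ((1 + (m + k) * 2) * 2)     ≡⟨ w[4k+2]≡b (m + k) ⟩
    b                             ≡⟨ w[4k+2]≡b k ⟨
    w ((1 + k * 2) * 2)           ∎
    where
    index : ∀ m k → m * 4 + (1 + k * 2) * 2 ≡ (1 + (m + k) * 2) * 2
    index = solve-∀

  w-repeats : ∀ n i → i < 2 ^ n → w (2 ^ n * 4 + i) ≡ w i
  w-repeats zero zero _ = w[4m+2j]≡w[2j] 1 0
  w-repeats zero (suc i) (s≤s ())
  w-repeats (suc n) i i<2^[1+n] with parityView i
  ... | even j = w[4m+2j]≡w[2j] (2 ^ suc n) j
  ... | odd j = begin
    w (2 ^ suc n * 4 + (1 + j * 2))   ≡⟨ cong w (index (2 ^ n) j) ⟩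
    w (1 + (2 ^ n * 4 + j) * 2)       ≡⟨ w[2i+1]≡w[i] (2 ^ n * 4 + j) ⟩
    w (2 ^ n * 4 + j)                 ≡⟨ w-repeats n j j<2^n ⟩
    w j                               ≡⟨ w[2i+1]≡w[i] j ⟨
    w (1 + j * 2)                     ∎
    where
    index : ∀ x j → 2 * x * 4 + (1 + j * 2) ≡ 1 + (x * 4 + j) * 2
    index = solve-∀
    j<2^n : j < 2 ^ n
    j<2^n = *-cancelʳ-< 2 j (2 ^ n)
      (<-trans (n<1+n (j * 2)) (<-≤-trans i<2^[1+n] (≤-reflexive (*-comm 2 (2 ^ n)))))

  no-odd-period : a ≢ b → ∀ N j → ¬ PeriodicFrom N (1 + j * 2) w
  no-odd-period a≢b N j periodic = a≢b (begin
    a                          ≡⟨ w[4k]≡a N ⟨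
    w (N * 2 * 2)              ≡⟨ periodic _ N≤4N ⟨
    w (N * 2 * 2 + p)          ≡⟨ periodic _ (≤-trans N≤4N (m≤m+n _ p)) ⟨
    w (N * 2 * 2 + p + p)      ≡⟨ cong w (index N j) ⟩
    w ((1 + (N + j) * 2) * 2)  ≡⟨ w[4k+2]≡b (N + j) ⟩
    b                          ∎)
    where
    p : ℕ
    p = 1 + j * 2
    N≤4N : N ≤ N * 2 * 2
    N≤4N = ≤-trans (m≤m*n N 2) (m≤m*n (N * 2) 2)
    index : ∀ N j → N * 2 * 2 + (1 + j * 2) + (1 + j * 2) ≡ (1 + (N + j) * 2) * 2
    index = solve-∀

  period-halves : ∀ {N} q → PeriodicFrom N (q * 2) w → PeriodicFrom N q w
  period-halves {N} q periodic n N≤n = begin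
    w (n + q)              ≡⟨ w[2i+1]≡w[i] (n + q) ⟨
    w (1 + (n + q) * 2)    ≡⟨ cong (w ∘ suc) (*-distribʳ-+ 2 n q) ⟩
    w (1 + n * 2 + q * 2)  ≡⟨ periodic (1 + n * 2) N≤1+2n ⟩
    w (1 + n * 2)          ≡⟨ w[2i+1]≡w[i] n ⟩
    w n                    ∎
    where
    N≤1+2n : N ≤ 1 + n * 2
    N≤1+2n = ≤-trans N≤n (≤-trans (m≤m*n n 2) (n≤1+n _))

  aperiodic : a ≢ b → ∀ {N} p → Acc _<_ p → 1 ≤ p → ¬ PeriodicFrom N p w
  aperiodic a≢b p (acc smaller) 1≤p periodic with parityView p
  aperiodic a≢b _ _ () _ | even zero
  ... | even (suc j) =
    aperiodic a≢b (suc j) (smaller (m<m*n (suc j) 2 (s≤s (s≤s z≤n)))) (s≤s z≤n)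
      (period-halves (suc j) periodic)
  ... | odd j = no-odd-period a≢b _ j periodic

  not-ultimately-periodic : a ≢ b → ¬ UltimatelyPeriodic w
  not-ultimately-periodic a≢b (p , N , 1≤p , periodic) =
    aperiodic a≢b p (<-wellFounded p) 1≤p periodic

proposition2p5 : {A : Set} (a b : A) → a ≢ b → Spade 13 (paperfolding a b)
proposition2p5 {A} a b a≢b =
  not-ultimately-periodic a≢b , U , V , W , prefix , 0<|U| , |V|≤13|U| , |W|≤13|U| , unbounded
  where
  open Paperfolding a b
  U V W : ℕ → List A
  U n = applyUpTo w (2 ^ n)
  V n = applyUpTo (λ i → w (2 ^ n + i)) (2 ^ n * 3)
  W n = []
  prefix : ∀ n → IsPrefix (W n ++ U n ++ V n ++ U n) w
  prefix n = UVU-IsPrefix w (2 ^ n) (2 ^ n * 3)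
    (λ i → trans (cong (λ s → w (s + i)) (sym (*-suc (2 ^ n) 3))) ∘ w-repeats n i)
  |U|≡2^n : ∀ n → length (U n) ≡ 2 ^ n
  |U|≡2^n n = length-applyUpTo w (2 ^ n)
  0<|U| : ∀ n → 0 < length (U n)
  0<|U| n rewrite |U|≡2^n n = m^n>0 2 n
  |V|≤13|U| : ∀ n → length (V n) ≤ 13 * length (U n)
  |V|≤13|U| n rewrite |U|≡2^n n | length-applyUpTo (λ i → w (2 ^ n + i)) (2 ^ n * 3) =
    ≤-trans (≤-reflexive (*-comm (2 ^ n) 3)) (*-monoˡ-≤ (2 ^ n) (m≤m+n 3 10))
  |W|≤13|U| : ∀ n → length (W n) ≤ 13 * length (U n)
  |W|≤13|U| n = z≤n
  unbounded : ∀ B → Σ ℕ λ n → B < length (U n)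
  unbounded B = B , subst (B <_) (sym (|U|≡2^n B)) (n<2^n B)
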